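{- Let $p=\underline{p_1p_2\cdots p_\ell}$ be a consecutive pattern with an extendable index $i$. Let $\sigma\in\mathfrak S_{\ell-i+1}$ be the permutation with $p_{\sigma(1)}<p_{\sigma(2)}<\cdots<p_{\sigma(\ell-i+1)}$. Set $\delta_1^1:=p_{\sigma(1)}-1$, $\delta_1^2:=p_{\sigma(1)+i-1}-1$, $\delta_{\ell-i+2}^1:=\ell-p_{\sigma(\ell-i+1)}$, $\delta_{\ell-i+2}^2:=\ell-p_{\sigma(\ell-i+1)+i-1}$, and for $j=2,\ldots,\ell-i+1$: $\delta_j^1:=p_{\sigma(j)}-p_{\sigma(j-1)}-1$, $\delta_j^2:=p_{\sigma(j)+i-1}-p_{\sigma(j-1)+i-1}-1$; and $\Delta_j^1:=\min\{\delta_j^1,\delta_j^2\}$, $\Delta_j^2:=|\delta_j^1-\delta_j^2|$ for $j=1,\ldots,\ell-i+2$. Then the extended multiset of $p$ at the index $i$ is $$M(\underbrace{2,\ldots,2}_{\Delta_1^1},\underbrace{1,\ldots,1}_{\Delta_1^2+1},\underbrace{2,\ldots,2}_{\Delta_2^1},\underbrace{1,\ldots,1}_{\Delta_2^2+1},\ldots,\underbrace{2,\ldots,2}_{\Delta_{\ell-i+1}^1},\underbrace{1,\ldots,1}_{\Delta_{\ell-i+1}^2+1},\underbrace{2,\ldots,2}_{\Delta_{\ell-i+2}^1},\underbrace{1,\ldots,1}_{\Delta_{\ell-i+2}^2}).$$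
   Context: $M(k_1,\ldots,k_n)$ is the multiset containing the letter $j$ exactly $k_j$ times. A consecutive pattern $p=\underline{p_1\cdots p_\ell}$ is a permutation $p_1\cdots p_\ell$ of $\{1,\ldots,\ell\}$; a factor $\pi_a\pi_{a+1}\cdots\pi_{a+\ell-1}$ of a word over positive integers forms an occurrence of $p$ if for all $j,k$, $\pi_{a+j-1}<\pi_{a+k-1}$ iff $p_j<p_k$ (in particular its letters are distinct). An index $i$ with $2\le i\le\ell$ is extendable if there is a word $\pi=\pi_1\cdots\pi_{\ell+i-1}$ over positive integers whose first $\ell$ letters and whose last $\ell$ letters each form an occurrence of $p$. Among all such words, the one that is minimal in lexicographic order (comparing $\pi_1$ first, then $\pi_2$, etc.) is the extended permutation of $p$ at $i$, and the multiset of its letters (written as $M(k_1,\ldots,k_n)$, $k_j$ = number of occurrences of letter $j$) is the extended multiset of $p$ at $i$. -}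

module Defs where

open import Data.Nat using (ℕ; zero; suc; _+_; _∸_; _≤_; _<_; _⊔_; _⊓_; _≡ᵇ_)
open import Data.Bool using (if_then_else_)
open import Data.List using (List; []; _∷_; length; map; upTo; replicate; _++_; concat; concatMap; zipWith)
open import Data.List.Relation.Unary.All using (All)
open import Data.List.Relation.Binary.Permutation.Propositional using (_↭_)
open import Data.Product using (_×_; ∃)
open import Function.Bundles using (_⇔_)
open import Relation.Binary.PropositionalEquality using (_≡_)

-- 0-based total indexing into a list of naturals (0 outside the range)
at : List ℕ → ℕ → ℕ
at []       _       = 0
at (x ∷ xs) zero    = x
at (x ∷ xs) (suc n) = at xs n

-- 1-based letter p_j of a list (paper indexing)
P : List ℕ → ℕ → ℕ
P p j = at p (j ∸ 1)

IsPattern : List ℕ → Set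
IsPattern p = p ↭ map suc (upTo (length p))

-- the factor w_{a+1} ⋯ w_{a+ℓ} of w (a is a 0-based offset) is an
-- occurrence of the consecutive pattern p (ℓ = length p)
IsOccAt : List ℕ → List ℕ → ℕ → Set
IsOccAt p w a = ∀ j k → j < length p → k < length p →
  (at w (a + j) < at w (a + k)) ⇔ (at p j < at p k)

-- w = π_1 ⋯ π_{ℓ+i-1} is a word over positive integers whose first ℓ
-- letters and whose last ℓ letters each form an occurrence of p
IsOverlapWord : List ℕ → ℕ → List ℕ → Set
IsOverlapWord p i w =
  length w ≡ length p + i ∸ 1 × All (λ x → 1 ≤ x) w
  × IsOccAt p w 0 × IsOccAt p w (i ∸ 1)

Extendable : List ℕ → ℕ → Set
Extendable p i = 2 ≤ i × i ≤ length p × ∃ (IsOverlapWord p i)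

data LexLe : List ℕ → List ℕ → Set where
  lex-[]    : LexLe [] []
  lex-here  : ∀ {x y xs ys} → x < y → length xs ≡ length ys → LexLe (x ∷ xs) (y ∷ ys)
  lex-there : ∀ {x xs ys} → LexLe xs ys → LexLe (x ∷ xs) (x ∷ ys)

IsExtendedPerm : List ℕ → ℕ → List ℕ → Set
IsExtendedPerm p i w = IsOverlapWord p i w × (∀ w′ → IsOverlapWord p i w′ → LexLe w w′)

-- σ ∈ 𝔖_{ℓ-i+1} (1-based, as a function on ℕ restricted to {1,…,ℓ-i+1})
-- with p_{σ(1)} < p_{σ(2)} < ⋯ < p_{σ(ℓ-i+1)}
IsSortingPerm : List ℕ → ℕ → (ℕ → ℕ) → Set
IsSortingPerm p i σ =
  (∀ j → 1 ≤ j → j ≤ m → 1 ≤ σ j × σ j ≤ m)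
  × (∀ j k → 1 ≤ j → j ≤ m → 1 ≤ k → k ≤ m → σ j ≡ σ k → j ≡ k)
  × (∀ j → 1 ≤ j → j < m → P p (σ j) < P p (σ (suc j)))
  where m = length p + 1 ∸ i

module _ (p : List ℕ) (i : ℕ) (σ : ℕ → ℕ) where
  private
    ℓ = length p
    m = ℓ + 1 ∸ i

  δ¹ : ℕ → ℕ
  δ¹ j = if j ≡ᵇ 1 then P p (σ 1) ∸ 1
         else if j ≡ᵇ suc m then ℓ ∸ P p (σ m)
         else P p (σ j) ∸ P p (σ (j ∸ 1)) ∸ 1

  δ² : ℕ → ℕ
  δ² j = if j ≡ᵇ 1 then P p (σ 1 + i ∸ 1) ∸ 1
         else if j ≡ᵇ suc m then ℓ ∸ P p (σ m + i ∸ 1)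
         else P p (σ j + i ∸ 1) ∸ P p (σ (j ∸ 1) + i ∸ 1) ∸ 1

  Δ¹ : ℕ → ℕ
  Δ¹ j = δ¹ j ⊓ δ² j

  Δ² : ℕ → ℕ
  Δ² j = (δ¹ j ∸ δ² j) ⊔ (δ² j ∸ δ¹ j)

  block : ℕ → List ℕ
  block j = replicate (Δ¹ j) 2 ++ replicate (Δ² j + (if j ≡ᵇ suc m then 0 else 1)) 1

  extMultiplicities : List ℕ
  extMultiplicities = concatMap block (map suc (upTo (suc m)))

-- M(k_1,…,k_n) as a list containing letter t exactly k_t times
M : List ℕ → List ℕ
M ks = concat (zipWith (λ t k → replicate k t) (map suc (upTo (length ks))) ks)

-- The letters of positions i, …, ℓ of the first copy of p are those of positions 1, …, ℓ − i + 1 of the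
-- second copy. Listing these overlap letters by increasing value, the j-th one has rank B j = p_{σ(j)}
-- in the second copy and rank A j = p_{σ(j)+i−1} in the first. Between the (j − 1)-th and the j-th
-- overlap letter lie δ_j^1 letters of the second copy and δ_j^2 letters of the first, so in any
-- overlap word they differ by at least 1 + max(δ_j^1, δ_j^2), and every other letter exceeds the
-- overlap letter below it in its copy by at least its rank distance. The word meeting all these
-- bounds with equality is itself an overlap word, hence the lexicographic minimum. Its letters
-- strictly between two consecutive overlap letters are the δ_j^1 and the δ_j^2 smallest values
-- available there, i.e. Δ_j^1 values twice and Δ_j^2 values once, followed by the overlap letter.

module Submission where

open import Defs
open import Data.Nat
  using (ℕ; zero; suc; pred; _≡ᵇ_; _+_; _∸_; _≤_; _<_; _⊔_; _⊓_; _≤′_; ≤′-refl; ≤′-step; z≤n; s≤s; _≤?_; _<?_)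
open import Data.Nat.Properties
open import Data.List
  using (List; []; _∷_; length; map; upTo; applyUpTo; replicate; _++_; concat; concatMap; zipWith; [_])
import Data.List.Properties as List
open import Data.List.Membership.Propositional using (_∈_)
open import Data.List.Membership.Propositional.Properties using (∈-∃++; ∈-map⁻)
open import Data.List.Relation.Unary.Any using (here; there)
open import Data.List.Relation.Unary.AllPairs using ([]; _∷_)
open import Data.List.Relation.Unary.All using (All)
import Data.List.Relation.Unary.All as All
open import Data.List.Relation.Unary.Unique.Propositional using (Unique)
open import Data.List.Relation.Unary.Unique.Propositional.Properties using (Unique[x∷xs]⇒x∉xs; upTo⁺)
  renaming (map⁺ to Unique-map⁺)
open import Data.List.Relation.Binary.Permutation.Propositional
  using (_↭_; ↭-refl; ↭-reflexive; ↭-sym; ↭-trans; prep; module PermutationReasoning)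
open import Data.List.Relation.Binary.Permutation.Propositional.Properties
  using (drop-∷; shift; shifts; ∈-resp-↭; ↭-length; ++-comm; ++-assoc; ++⁺ˡ; ++⁺ʳ; ++⁺; map⁺)
open import Data.Product using (_×_; _,_; proj₁; proj₂; ∃; Σ-syntax)
open import Data.Bool using (true; false)
open import Data.Sum using (inj₁; inj₂)
open import Data.Empty using (⊥-elim)
open import Function.Bundles using (_⇔_; mk⇔; Equivalence)
open import Relation.Nullary using (¬_; yes; no)
open import Relation.Binary.Definitions using (tri<; tri≈; tri>)
open import Relation.Binary.PropositionalEquality
  using (_≡_; _≢_; refl; sym; trans; cong; cong₂; subst; subst₂; module ≡-Reasoning)

-- Arithmetic

∸-split : ∀ {a b c} → a ≤ b → b ≤ c → c ∸ a ≡ (b ∸ a) + (c ∸ b)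
∸-split {a} {b} {c} a≤b b≤c = begin
  c ∸ a                         ≡⟨ cong (_∸ a) (sym a+[b∸a]+[c∸b]≡c) ⟩
  a + ((b ∸ a) + (c ∸ b)) ∸ a   ≡⟨ m+n∸m≡n a _ ⟩
  (b ∸ a) + (c ∸ b)             ∎
  where
  open ≡-Reasoning
  a+[b∸a]+[c∸b]≡c : a + ((b ∸ a) + (c ∸ b)) ≡ c
  a+[b∸a]+[c∸b]≡c = trans (sym (+-assoc a _ _))
    (trans (cong (_+ (c ∸ b)) (m+[n∸m]≡n a≤b)) (m+[n∸m]≡n b≤c))

≡ᵇ-refl : ∀ a → (a ≡ᵇ a) ≡ true
≡ᵇ-refl zero    = refl
≡ᵇ-refl (suc a) = ≡ᵇ-refl a

≢⇒≡ᵇ≡false : ∀ {a b} → a ≢ b → (a ≡ᵇ b) ≡ false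
≢⇒≡ᵇ≡false {zero}  {zero}  0≢0   = ⊥-elim (0≢0 refl)
≢⇒≡ᵇ≡false {zero}  {suc b} _     = refl
≢⇒≡ᵇ≡false {suc a} {zero}  _     = refl
≢⇒≡ᵇ≡false {suc a} {suc b} a+1≢b+1 = ≢⇒≡ᵇ≡false (λ a≡b → a+1≢b+1 (cong suc a≡b))

m<n⇒n∸m≡1+[n∸m∸1] : ∀ {a b} → a < b → b ∸ a ≡ suc (b ∸ a ∸ 1)
m<n⇒n∸m≡1+[n∸m∸1] {a} {b} a<b with b ∸ a | m<n⇒0<n∸m a<b
... | suc d | _ = refl

module _ {m : ℕ} (f : ℕ → ℕ) (f-step : ∀ j → j < m → f j ≤ f (suc j)) where

  stepwise-mono≤ : ∀ {j k} → j ≤ k → k ≤ m → f j ≤ f k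
  stepwise-mono≤ j≤k = go (≤⇒≤′ j≤k)
    where
    go : ∀ {j k} → j ≤′ k → k ≤ m → f j ≤ f k
    go ≤′-refl         _   = ≤-refl
    go (≤′-step j≤′k) k<m = ≤-trans (go j≤′k (<⇒≤ k<m)) (f-step _ k<m)

module _ {m : ℕ} (X H : ℕ → ℕ) (X-step : ∀ j → j < m → X j ≤ X (suc j))
  (H-step : ∀ j → j < m → H j + (X (suc j) ∸ X j) ≤ H (suc j)) where

  gap-accumulate : ∀ {j k} → j ≤ k → k ≤ m → H j + (X k ∸ X j) ≤ H k
  gap-accumulate j≤k = go (≤⇒≤′ j≤k)
    where
    go : ∀ {j k} → j ≤′ k → k ≤ m → H j + (X k ∸ X j) ≤ H k
    go {j} ≤′-refl _ = ≤-reflexive (trans (cong (H j +_) (n∸n≡0 (X j))) (+-identityʳ (H j)))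
    go {j} (≤′-step {k} j≤′k) k<m = begin
      H j + (X (suc k) ∸ X j)                   ≡⟨ cong (H j +_) (∸-split Xj≤Xk (X-step k k<m)) ⟩
      H j + ((X k ∸ X j) + (X (suc k) ∸ X k))   ≡⟨ +-assoc (H j) _ _ ⟨
      H j + (X k ∸ X j) + (X (suc k) ∸ X k)     ≤⟨ +-monoˡ-≤ _ (go j≤′k (<⇒≤ k<m)) ⟩
      H k + (X (suc k) ∸ X k)                   ≤⟨ H-step k k<m ⟩
      H (suc k)                                 ∎
      where
      open ≤-Reasoning
      Xj≤Xk : X j ≤ X k
      Xj≤Xk = stepwise-mono≤ X X-step (≤′⇒≤ j≤′k) (<⇒≤ k<m)

strictMono-gap : ∀ {ℓ} (F : ℕ → ℕ) → (∀ r → r < ℓ → F r < F (suc r)) →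
  ∀ {r r′} → r ≤ r′ → r′ ≤ ℓ → F r + (r′ ∸ r) ≤ F r′
strictMono-gap {ℓ} F F-step = gap-accumulate (λ r → r) F (λ r _ → n≤1+n r) step
  where
  step : ∀ r → r < ℓ → F r + (suc r ∸ r) ≤ F (suc r)
  step r r<ℓ = subst (λ d → F r + d ≤ F (suc r)) (sym (m+n∸n≡m 1 r))
    (subst (_≤ F (suc r)) (+-comm 1 (F r)) (F-step r r<ℓ))

strictMono⇒<⇔< : (g : ℕ → ℕ) → (∀ a b → a < b → g a < g b) → ∀ a b → (g a < g b) ⇔ (a < b)
strictMono⇒<⇔< g g-mono a b = mk⇔ reflect (g-mono a b)
  where
  reflect : g a < g b → a < b
  reflect ga<gb with <-cmp a b
  ... | tri< a<b _ _ = a<b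
  ... | tri≈ _ refl _ = ⊥-elim (<-irrefl refl ga<gb)
  ... | tri> _ _ b<a = ⊥-elim (<-asym ga<gb (g-mono b a b<a))

-- Intervals of naturals

range : ℕ → ℕ → List ℕ
range o zero    = []
range o (suc c) = o ∷ range (suc o) c

length-range : ∀ o c → length (range o c) ≡ c
length-range o zero    = refl
length-range o (suc c) = cong suc (length-range (suc o) c)

range-++ : ∀ o a b → range o (a + b) ≡ range o a ++ range (o + a) b
range-++ o zero    b = cong (λ o′ → range o′ b) (sym (+-identityʳ o))
range-++ o (suc a) b = cong (o ∷_) (trans (range-++ (suc o) a b)
  (cong (λ o′ → range (suc o) a ++ range o′ b) (sym (+-suc o a))))

range-∷ʳ : ∀ o c → range o (suc c) ≡ range o c ++ [ o + c ]
range-∷ʳ o c = trans (cong (range o) (+-comm 1 c)) (range-++ o c 1)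

map-suc-range : ∀ o c → map suc (range o c) ≡ range (suc o) c
map-suc-range o zero    = refl
map-suc-range o (suc c) = cong (suc o ∷_) (map-suc-range (suc o) c)

applyUpTo-range : ∀ {A : Set} (f : ℕ → A) c → applyUpTo f c ≡ map f (range 0 c)
applyUpTo-range f zero    = refl
applyUpTo-range f (suc c) = cong (f 0 ∷_) (begin
  applyUpTo (λ x → f (suc x)) c       ≡⟨ applyUpTo-range (λ x → f (suc x)) c ⟩
  map (λ x → f (suc x)) (range 0 c)   ≡⟨ List.map-∘ (range 0 c) ⟩
  map f (map suc (range 0 c))         ≡⟨ cong (map f) (map-suc-range 0 c) ⟩
  map f (range 1 c)                   ∎)
  where open ≡-Reasoning

upTo-range : ∀ c → upTo c ≡ range 0 c
upTo-range c = trans (applyUpTo-range (λ x → x) c) (List.map-id (range 0 c))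

map-suc-upTo : ∀ c → map suc (upTo c) ≡ range 1 c
map-suc-upTo c = trans (cong (map suc) (upTo-range c)) (map-suc-range 0 c)

∈-range⁻ : ∀ {x} o c → x ∈ range o c → o ≤ x × x < o + c
∈-range⁻ o (suc c) (here refl) = ≤-refl , subst (o <_) (sym (+-suc o c)) (s≤s (m≤m+n o c))
∈-range⁻ {x} o (suc c) (there x∈) with ∈-range⁻ (suc o) c x∈
... | o<x , x<o+c = <⇒≤ o<x , subst (x <_) (sym (+-suc o c)) x<o+c

∈-range⁺ : ∀ {x} o c → o ≤ x → x < o + c → x ∈ range o c
∈-range⁺ o zero    o≤x x<o+0 = ⊥-elim (<-irrefl refl (<-≤-trans x<o+0 (subst (_≤ _) (sym (+-identityʳ o)) o≤x)))
∈-range⁺ {x} o (suc c) o≤x x<o+c with o ≟ x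
... | yes refl = here refl
... | no o≢x   = there (∈-range⁺ (suc o) c (≤∧≢⇒< o≤x o≢x) (subst (x <_) (+-suc o c) x<o+c))

map-cong-range : ∀ {A : Set} (f g : ℕ → A) o c → (∀ j → j < c → f (o + j) ≡ g (o + j)) →
  map f (range o c) ≡ map g (range o c)
map-cong-range f g o zero    f≗g = refl
map-cong-range f g o (suc c) f≗g = cong₂ _∷_
  (trans (cong f (sym (+-identityʳ o))) (trans (f≗g 0 (s≤s z≤n)) (cong g (+-identityʳ o))))
  (map-cong-range f g (suc o) c λ j j<c →
    trans (cong f (sym (+-suc o j))) (trans (f≗g (suc j) (s≤s j<c)) (cong g (+-suc o j))))

map-range-translate : ∀ (f : ℕ → ℕ) o o′ c → (∀ j → j < c → f (o + j) ≡ o′ + j) →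
  map f (range o c) ≡ range o′ c
map-range-translate f o o′ zero    f≗ = refl
map-range-translate f o o′ (suc c) f≗ = cong₂ _∷_
  (trans (cong f (sym (+-identityʳ o))) (trans (f≗ 0 (s≤s z≤n)) (+-identityʳ o′)))
  (map-range-translate f (suc o) (suc o′) c λ j j<c →
    trans (cong f (sym (+-suc o j))) (trans (f≗ (suc j) (s≤s j<c)) (+-suc o′ j)))

map-range-+ : ∀ (f : ℕ → ℕ) o d c → map f (range (o + d) c) ≡ map (λ x → f (o + x)) (range d c)
map-range-+ f o d zero    = refl
map-range-+ f o d (suc c) = cong (f (o + d) ∷_)
  (trans (cong (λ o′ → map f (range o′ c)) (sym (+-suc o d))) (map-range-+ f o (suc d) c))

at-map-range : ∀ (f : ℕ → ℕ) o c j → j < c → at (map f (range o c)) j ≡ f (o + j)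
at-map-range f o (suc c) zero    _         = cong f (sym (+-identityʳ o))
at-map-range f o (suc c) (suc j) (s≤s j<c) = trans (at-map-range f (suc o) c j j<c) (cong f (sym (+-suc o j)))

map-at-range : ∀ (p : List ℕ) → map (at p) (range 0 (length p)) ≡ p
map-at-range []       = refl
map-at-range (x ∷ xs) = cong (x ∷_) (begin
  map (at (x ∷ xs)) (range 1 (length xs))           ≡⟨ cong (map (at (x ∷ xs))) (map-suc-range 0 (length xs)) ⟨
  map (at (x ∷ xs)) (map suc (range 0 (length xs))) ≡⟨ List.map-∘ (range 0 (length xs)) ⟨
  map (at xs) (range 0 (length xs))                 ≡⟨ map-at-range xs ⟩
  xs                                                ∎)
  where open ≡-Reasoning

at-∈ : ∀ (p : List ℕ) k → k < length p → at p k ∈ p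
at-∈ (x ∷ xs) zero    _         = here refl
at-∈ (x ∷ xs) (suc k) (s≤s k<ℓ) = there (at-∈ xs k k<ℓ)

indexOf : List ℕ → ℕ → ℕ
indexOf []       r = 0
indexOf (x ∷ xs) r with x ≟ r
... | yes _ = 0
... | no _  = suc (indexOf xs r)

indexOf-spec : ∀ (p : List ℕ) {r} → r ∈ p → indexOf p r < length p × at p (indexOf p r) ≡ r
indexOf-spec (x ∷ xs) {r} r∈p with x ≟ r
... | yes x≡r = s≤s z≤n , x≡r
indexOf-spec (x ∷ xs) (here r≡x)  | no x≢r = ⊥-elim (x≢r (sym r≡x))
indexOf-spec (x ∷ xs) (there r∈xs) | no _ with indexOf-spec xs r∈xs
... | i<ℓ , at≡r = s≤s i<ℓ , at≡r

-- Permutations and the lexicographic order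

↭-cancelˡ : ∀ (xs : List ℕ) {ys zs} → xs ++ ys ↭ xs ++ zs → ys ↭ zs
↭-cancelˡ []       ys↭zs = ys↭zs
↭-cancelˡ (x ∷ xs) ys↭zs = ↭-cancelˡ xs (drop-∷ ys↭zs)

++-interchange : ∀ (a b c d : List ℕ) → (a ++ b) ++ (c ++ d) ↭ (a ++ c) ++ (b ++ d)
++-interchange a b c d =
  ↭-trans (++-assoc a b (c ++ d)) (↭-trans (++⁺ˡ a (shifts b c)) (↭-sym (++-assoc a c (b ++ d))))

Unique⊆⇒↭ : ∀ {xs ys : List ℕ} → Unique xs → (∀ {y} → y ∈ xs → y ∈ ys) →
  length xs ≡ length ys → xs ↭ ys
Unique⊆⇒↭ {[]} {[]} _ _ _ = ↭-refl
Unique⊆⇒↭ {x ∷ xs} ux∷xs@(_ ∷ uxs) xs⊆ys |xs|≡|ys| with ∈-∃++ (xs⊆ys (here refl))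
... | as , bs , refl = ↭-trans (prep x (Unique⊆⇒↭ uxs xs⊆as++bs |xs|≡|as++bs|)) (↭-sym (shift x as bs))
  where
  xs⊆as++bs : ∀ {y} → y ∈ xs → y ∈ as ++ bs
  xs⊆as++bs {y} y∈xs with ∈-resp-↭ (shift x as bs) (xs⊆ys (there y∈xs))
  ... | here refl  = ⊥-elim (Unique[x∷xs]⇒x∉xs ux∷xs y∈xs)
  ... | there y∈  = y∈
  |xs|≡|as++bs| : length xs ≡ length (as ++ bs)
  |xs|≡|as++bs| = suc-injective (trans |xs|≡|ys| (↭-length (shift x as bs)))

Unique-map⁺-on : ∀ {f : ℕ → ℕ} {xs} → (∀ {a b} → a ∈ xs → b ∈ xs → f a ≡ f b → a ≡ b) →
  Unique xs → Unique (map f xs)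
Unique-map⁺-on _ [] = []
Unique-map⁺-on {f} {x ∷ xs} inj (x∉xs ∷ uxs) =
  All.tabulate fx≢ ∷ Unique-map⁺-on (λ a∈ b∈ → inj (there a∈) (there b∈)) uxs
  where
  fx≢ : ∀ {y} → y ∈ map f xs → f x ≢ y
  fx≢ y∈ fx≡y with ∈-map⁻ f y∈
  ... | b , b∈xs , refl = All.lookup x∉xs b∈xs (inj (here refl) (there b∈xs) fx≡y)

pointwise≤⇒LexLe : ∀ (xs ys : List ℕ) → length xs ≡ length ys →
  (∀ k → k < length xs → at xs k ≤ at ys k) → LexLe xs ys
pointwise≤⇒LexLe []       []       _   _     = lex-[]
pointwise≤⇒LexLe (x ∷ xs) (y ∷ ys) len xs≤ys with m≤n⇒m<n∨m≡n (xs≤ys 0 (s≤s z≤n))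
... | inj₁ x<y  = lex-here x<y (suc-injective len)
... | inj₂ refl = lex-there (pointwise≤⇒LexLe xs ys (suc-injective len) (λ k k< → xs≤ys (suc k) (s≤s k<)))

LexLe-antisym : ∀ {xs ys} → LexLe xs ys → LexLe ys xs → xs ≡ ys
LexLe-antisym lex-[]          _               = refl
LexLe-antisym (lex-here x<y _) (lex-here y<x _) = ⊥-elim (<-asym x<y y<x)
LexLe-antisym (lex-here x<x _) (lex-there _)    = ⊥-elim (<-irrefl refl x<x)
LexLe-antisym (lex-there _)    (lex-here x<x _) = ⊥-elim (<-irrefl refl x<x)
LexLe-antisym {x ∷ _} (lex-there xs≤ys) (lex-there ys≤xs) = cong (x ∷_) (LexLe-antisym xs≤ys ys≤xs)

-- Multiplicity lists

-- The multiset M(k₁,…,kₙ) written over the letters o+1, …, o+n.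
Mfrom : ℕ → List ℕ → List ℕ
Mfrom o []       = []
Mfrom o (k ∷ ks) = replicate k (suc o) ++ Mfrom (suc o) ks

M≡Mfrom0 : ∀ ks → M ks ≡ Mfrom 0 ks
M≡Mfrom0 ks = trans (cong (λ ts → concat (zipWith (λ t k → replicate k t) ts ks)) (map-suc-upTo (length ks)))
  (zipWith-range 0 ks)
  where
  zipWith-range : ∀ o ks → concat (zipWith (λ t k → replicate k t) (range (suc o) (length ks)) ks) ≡ Mfrom o ks
  zipWith-range o []       = refl
  zipWith-range o (k ∷ ks) = cong (replicate k (suc o) ++_) (zipWith-range (suc o) ks)

Mfrom-++ : ∀ o xs ys → Mfrom o (xs ++ ys) ≡ Mfrom o xs ++ Mfrom (o + length xs) ys
Mfrom-++ o []       ys = cong (λ o′ → Mfrom o′ ys) (sym (+-identityʳ o))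
Mfrom-++ o (x ∷ xs) ys = begin
  replicate x (suc o) ++ Mfrom (suc o) (xs ++ ys)
    ≡⟨ cong (replicate x (suc o) ++_) (Mfrom-++ (suc o) xs ys) ⟩
  replicate x (suc o) ++ (Mfrom (suc o) xs ++ Mfrom (suc o + length xs) ys)
    ≡⟨ List.++-assoc (replicate x (suc o)) _ _ ⟨
  (replicate x (suc o) ++ Mfrom (suc o) xs) ++ Mfrom (suc o + length xs) ys
    ≡⟨ cong (λ o′ → (replicate x (suc o) ++ Mfrom (suc o) xs) ++ Mfrom o′ ys) (sym (+-suc o (length xs))) ⟩
  (replicate x (suc o) ++ Mfrom (suc o) xs) ++ Mfrom (o + suc (length xs)) ys ∎
  where open ≡-Reasoning

Mfrom-ones : ∀ o c → Mfrom o (replicate c 1) ≡ range (suc o) c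
Mfrom-ones o zero    = refl
Mfrom-ones o (suc c) = cong (suc o ∷_) (Mfrom-ones (suc o) c)

Mfrom-twos : ∀ o a → Mfrom o (replicate a 2) ↭ range (suc o) a ++ range (suc o) a
Mfrom-twos o zero    = ↭-refl
Mfrom-twos o (suc a) = prep (suc o)
  (↭-trans (prep (suc o) (Mfrom-twos (suc o) a)) (↭-sym (shift (suc o) (range (suc (suc o)) a) _)))

Mfrom-twos-++-range : ∀ o a b →
  Mfrom o (replicate a 2) ++ range (suc (o + a)) b ↭ range (suc o) a ++ range (suc o) (a + b)
Mfrom-twos-++-range o a b = begin
  Mfrom o (replicate a 2) ++ range (suc o + a) b      ↭⟨ ++⁺ʳ _ (Mfrom-twos o a) ⟩
  (range (suc o) a ++ range (suc o) a) ++ range (suc o + a) b ↭⟨ ++-assoc (range (suc o) a) _ _ ⟩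
  range (suc o) a ++ (range (suc o) a ++ range (suc o + a) b) ≡⟨ cong (range (suc o) a ++_) (range-++ (suc o) a b) ⟨
  range (suc o) a ++ range (suc o) (a + b)            ∎
  where open PermutationReasoning

⊓-+-dist≡⊔ : ∀ d₁ d₂ → d₁ ⊓ d₂ + ((d₁ ∸ d₂) ⊔ (d₂ ∸ d₁)) ≡ d₁ ⊔ d₂
⊓-+-dist≡⊔ d₁ d₂ with ≤-total d₁ d₂
... | inj₁ d₁≤d₂ rewrite m≤n⇒m⊓n≡m d₁≤d₂ | m≤n⇒m∸n≡0 d₁≤d₂ | m≤n⇒m⊔n≡n d₁≤d₂ = m+[n∸m]≡n d₁≤d₂
... | inj₂ d₂≤d₁ rewrite m≥n⇒m⊓n≡n d₂≤d₁ | m≤n⇒m∸n≡0 d₂≤d₁ | ⊔-identityʳ (d₁ ∸ d₂) | m≥n⇒m⊔n≡m d₂≤d₁ =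
  m+[n∸m]≡n d₂≤d₁

-- Two gaps of lengths d₁ and d₂ filled with the same smallest values.
Mfrom-twos-++-dist : ∀ o d₁ d₂ →
  Mfrom o (replicate (d₁ ⊓ d₂) 2) ++ range (suc (o + d₁ ⊓ d₂)) ((d₁ ∸ d₂) ⊔ (d₂ ∸ d₁))
    ↭ range (suc o) d₁ ++ range (suc o) d₂
Mfrom-twos-++-dist o d₁ d₂ with ≤-total d₁ d₂
... | inj₁ d₁≤d₂ rewrite m≤n⇒m⊓n≡m d₁≤d₂ | m≤n⇒m∸n≡0 d₁≤d₂ =
  subst (λ c → Mfrom o (replicate d₁ 2) ++ range (suc (o + d₁)) (d₂ ∸ d₁) ↭ range (suc o) d₁ ++ range (suc o) c)
    (m+[n∸m]≡n d₁≤d₂)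
    (Mfrom-twos-++-range o d₁ (d₂ ∸ d₁))
... | inj₂ d₂≤d₁ rewrite m≥n⇒m⊓n≡n d₂≤d₁ | m≤n⇒m∸n≡0 d₂≤d₁ | ⊔-identityʳ (d₁ ∸ d₂) =
  ↭-trans
    (subst (λ c → Mfrom o (replicate d₂ 2) ++ range (suc (o + d₂)) (d₁ ∸ d₂) ↭ range (suc o) d₂ ++ range (suc o) c)
      (m+[n∸m]≡n d₂≤d₁)
      (Mfrom-twos-++-range o d₂ (d₁ ∸ d₂)))
    (++-comm (range (suc o) d₂) _)

gapBlock : ℕ → ℕ → ℕ → List ℕ
gapBlock d₁ d₂ e = replicate (d₁ ⊓ d₂) 2 ++ replicate ((d₁ ∸ d₂) ⊔ (d₂ ∸ d₁) + e) 1

length-gapBlock : ∀ d₁ d₂ e → length (gapBlock d₁ d₂ e) ≡ d₁ ⊔ d₂ + e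
length-gapBlock d₁ d₂ e = begin
  length (gapBlock d₁ d₂ e)                       ≡⟨ List.length-++ (replicate (d₁ ⊓ d₂) 2) ⟩
  length (replicate (d₁ ⊓ d₂) 2) + length (replicate (dist + e) 1)
    ≡⟨ cong₂ _+_ (List.length-replicate (d₁ ⊓ d₂)) (List.length-replicate (dist + e)) ⟩
  d₁ ⊓ d₂ + (dist + e)                            ≡⟨ +-assoc (d₁ ⊓ d₂) dist e ⟨
  d₁ ⊓ d₂ + dist + e                              ≡⟨ cong (_+ e) (⊓-+-dist≡⊔ d₁ d₂) ⟩
  d₁ ⊔ d₂ + e                                     ∎
  where
  open ≡-Reasoning
  dist = (d₁ ∸ d₂) ⊔ (d₂ ∸ d₁)

Mfrom-gapBlock : ∀ o d₁ d₂ e →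
  Mfrom o (gapBlock d₁ d₂ e) ↭ (range (suc o) d₁ ++ range (suc o) d₂) ++ range (suc (o + (d₁ ⊔ d₂))) e
Mfrom-gapBlock o d₁ d₂ e = begin
  Mfrom o (gapBlock d₁ d₂ e)
    ≡⟨ Mfrom-++ o (replicate mn 2) _ ⟩
  Mfrom o (replicate mn 2) ++ Mfrom (o + length (replicate mn 2)) (replicate (dist + e) 1)
    ≡⟨ cong (λ n → Mfrom o (replicate mn 2) ++ Mfrom (o + n) (replicate (dist + e) 1)) (List.length-replicate mn) ⟩
  Mfrom o (replicate mn 2) ++ Mfrom (o + mn) (replicate (dist + e) 1)
    ≡⟨ cong (Mfrom o (replicate mn 2) ++_) (trans (Mfrom-ones (o + mn) (dist + e)) (range-++ (suc (o + mn)) dist e)) ⟩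
  Mfrom o (replicate mn 2) ++ (range (suc (o + mn)) dist ++ range (suc (o + mn) + dist) e)
    ↭⟨ ++-assoc (Mfrom o (replicate mn 2)) _ _ ⟨
  (Mfrom o (replicate mn 2) ++ range (suc (o + mn)) dist) ++ range (suc (o + mn) + dist) e
    ≡⟨ cong (λ n → (Mfrom o (replicate mn 2) ++ range (suc (o + mn)) dist) ++ range (suc n) e)
         (trans (+-assoc o mn dist) (cong (o +_) (⊓-+-dist≡⊔ d₁ d₂))) ⟩
  (Mfrom o (replicate mn 2) ++ range (suc (o + mn)) dist) ++ range (suc (o + (d₁ ⊔ d₂))) e
    ↭⟨ ++⁺ʳ _ (Mfrom-twos-++-dist o d₁ d₂) ⟩
  (range (suc o) d₁ ++ range (suc o) d₂) ++ range (suc (o + (d₁ ⊔ d₂))) e ∎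
  where
  open PermutationReasoning
  mn = d₁ ⊓ d₂
  dist = (d₁ ∸ d₂) ⊔ (d₂ ∸ d₁)

-- Filling between anchors

-- fill puts the value H k at the anchor position X k and increases with slope one up to the next anchor.
module Staircase {m : ℕ} (X H : ℕ → ℕ) (X₀≡0 : X 0 ≡ 0) (H₀≡0 : H 0 ≡ 0)
  (X-step : ∀ j → j < m → X j < X (suc j))
  (H-step : ∀ j → j < m → H j + (X (suc j) ∸ X j) ≤ H (suc j)) where

  private
    X-mono≤ : ∀ {j k} → j ≤ k → k ≤ m → X j ≤ X k
    X-mono≤ = stepwise-mono≤ X (λ j j<m → <⇒≤ (X-step j j<m))

    H-gap : ∀ {j k} → j ≤ k → k ≤ m → H j + (X k ∸ X j) ≤ H k
    H-gap = gap-accumulate X H (λ j j<m → <⇒≤ (X-step j j<m)) H-step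

    lastAnchor : ℕ → ℕ → ℕ
    lastAnchor r zero    = 0
    lastAnchor r (suc k) with X (suc k) ≤? r
    ... | yes _ = suc k
    ... | no _  = lastAnchor r k

    lastAnchor-≤ : ∀ r k → lastAnchor r k ≤ k
    lastAnchor-≤ r zero    = z≤n
    lastAnchor-≤ r (suc k) with X (suc k) ≤? r
    ... | yes _ = ≤-refl
    ... | no _  = m≤n⇒m≤1+n (lastAnchor-≤ r k)

    X-lastAnchor≤ : ∀ r k → X (lastAnchor r k) ≤ r
    X-lastAnchor≤ r zero    = subst (_≤ r) (sym X₀≡0) z≤n
    X-lastAnchor≤ r (suc k) with X (suc k) ≤? r
    ... | yes X≤r = X≤r
    ... | no _    = X-lastAnchor≤ r k

    lastAnchor-next : ∀ r k → k ≤ m → lastAnchor r k < k → r < X (suc (lastAnchor r k))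
    lastAnchor-next r (suc k) k<m a<k with X (suc k) ≤? r
    ... | yes _   = ⊥-elim (<-irrefl refl a<k)
    ... | no X≰r with m≤n⇒m<n∨m≡n (lastAnchor-≤ r k)
    ...   | inj₁ a<k′ = lastAnchor-next r k (<⇒≤ k<m) a<k′
    ...   | inj₂ a≡k  = subst (λ a → r < X (suc a)) (sym a≡k) (≰⇒> X≰r)

  anchor : ℕ → ℕ
  anchor r = lastAnchor r m

  anchor≤m : ∀ r → anchor r ≤ m
  anchor≤m r = lastAnchor-≤ r m

  X-anchor≤ : ∀ r → X (anchor r) ≤ r
  X-anchor≤ r = X-lastAnchor≤ r m

  anchor-next : ∀ r → anchor r < m → r < X (suc (anchor r))
  anchor-next r = lastAnchor-next r m ≤-refl

  anchor-unique : ∀ r k → k ≤ m → X k ≤ r → (k < m → r < X (suc k)) → anchor r ≡ k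
  anchor-unique r k k≤m Xk≤r r<Xk+1 with <-cmp (anchor r) k
  ... | tri≈ _ a≡k _ = a≡k
  ... | tri< a<k _ _ = ⊥-elim (<-irrefl refl (<-≤-trans (anchor-next r (<-≤-trans a<k k≤m))
                         (≤-trans (X-mono≤ a<k k≤m) Xk≤r)))
  ... | tri> _ _ k<a = ⊥-elim (<-irrefl refl (<-≤-trans (r<Xk+1 (<-≤-trans k<a (anchor≤m r)))
                         (≤-trans (X-mono≤ k<a (anchor≤m r)) (X-anchor≤ r))))

  anchor-mono : ∀ {r r′} → r ≤ r′ → anchor r ≤ anchor r′
  anchor-mono {r} {r′} r≤r′ with anchor r ≤? anchor r′
  ... | yes a≤a′ = a≤a′
  ... | no a≰a′  = ⊥-elim (<-irrefl refl (<-≤-trans (anchor-next r′ (<-≤-trans (≰⇒> a≰a′) (anchor≤m r)))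
                     (≤-trans (X-mono≤ (≰⇒> a≰a′) (anchor≤m r)) (≤-trans (X-anchor≤ r) r≤r′))))

  fill : ℕ → ℕ
  fill r = H (anchor r) + (r ∸ X (anchor r))

  fill-segment : ∀ r k → k ≤ m → X k ≤ r → (k < m → r < X (suc k)) → fill r ≡ H k + (r ∸ X k)
  fill-segment r k k≤m Xk≤r r<Xk+1 rewrite anchor-unique r k k≤m Xk≤r r<Xk+1 = refl

  fill-anchor : ∀ k → k ≤ m → fill (X k) ≡ H k
  fill-anchor k k≤m = trans (fill-segment (X k) k k≤m ≤-refl (X-step k))
    (trans (cong (H k +_) (n∸n≡0 (X k))) (+-identityʳ (H k)))

  ≤-fill : ∀ r → r ≤ fill r
  ≤-fill r = subst (_≤ fill r) (m+[n∸m]≡n (X-anchor≤ r)) (+-monoˡ-≤ (r ∸ X (anchor r)) X≤H)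
    where
    X≤H : X (anchor r) ≤ H (anchor r)
    X≤H = subst₂ (λ h x → h + (X (anchor r) ∸ x) ≤ H (anchor r)) H₀≡0 X₀≡0 (H-gap z≤n (anchor≤m r))

  fill-strictMono : ∀ r r′ → r < r′ → fill r < fill r′
  fill-strictMono r r′ r<r′ with m≤n⇒m<n∨m≡n (anchor-mono (<⇒≤ r<r′))
  ... | inj₂ a≡a′ = subst (λ a → H (anchor r) + (r ∸ X (anchor r)) < H a + (r′ ∸ X a)) a≡a′
                      (+-monoʳ-< (H (anchor r)) (∸-monoˡ-< r<r′ (X-anchor≤ r)))
  ... | inj₁ a<a′ = begin-strict
    H a + (r ∸ X a)    <⟨ +-monoʳ-< (H a) (∸-monoˡ-< r<Xa′ (X-anchor≤ r)) ⟩
    H a + (X a′ ∸ X a) ≤⟨ H-gap (<⇒≤ a<a′) (anchor≤m r′) ⟩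
    H a′               ≤⟨ m≤m+n (H a′) _ ⟩
    fill r′            ∎
    where
    open ≤-Reasoning
    a = anchor r
    a′ = anchor r′
    r<Xa′ : r < X a′
    r<Xa′ = <-≤-trans (anchor-next r (<-≤-trans a<a′ (anchor≤m r′))) (X-mono≤ a<a′ (anchor≤m r′))

  fill-range : ∀ k d → k ≤ m → (k < m → suc (X k) + d ≤ X (suc k)) →
    map fill (range (suc (X k)) d) ≡ range (suc (H k)) d
  fill-range k d k≤m fits = map-range-translate fill (suc (X k)) (suc (H k)) d λ j j<d → begin
    fill (suc (X k) + j)            ≡⟨ fill-segment _ k k≤m (≤-trans (n≤1+n (X k)) (m≤m+n (suc (X k)) j))
                                         (λ k<m → <-≤-trans (+-monoʳ-< (suc (X k)) j<d) (fits k<m)) ⟩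
    H k + (suc (X k) + j ∸ X k)     ≡⟨ cong (λ n → H k + (n ∸ X k)) (+-suc (X k) j) ⟨
    H k + (X k + suc j ∸ X k)       ≡⟨ cong (H k +_) (m+n∸m≡n (X k) (suc j)) ⟩
    H k + suc j                     ≡⟨ +-suc (H k) j ⟩
    suc (H k) + j                   ∎
    where open ≡-Reasoning

  fill-least : ∀ {ℓ} (F : ℕ → ℕ) → (∀ r → r < ℓ → F r < F (suc r)) → (∀ k → k ≤ m → H k ≤ F (X k)) →
    ∀ r → r ≤ ℓ → fill r ≤ F r
  fill-least F F-step H≤F r r≤ℓ = ≤-trans (+-monoˡ-≤ (r ∸ X (anchor r)) (H≤F (anchor r) (anchor≤m r)))
    (strictMono-gap F F-step (X-anchor≤ r) r≤ℓ)

  map-fill-next : ∀ k → k < m → map fill (range 1 (X (suc k))) ≡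
    map fill (range 1 (X k)) ++ (range (suc (H k)) (X (suc k) ∸ X k ∸ 1) ++ [ H (suc k) ])
  map-fill-next k k<m = begin
    map fill (range 1 (X (suc k)))
      ≡⟨ cong (λ x → map fill (range 1 x)) Xk+1+d≡ ⟨
    map fill (range 1 (X k + suc d))
      ≡⟨ cong (map fill) (trans (range-++ 1 (X k) (suc d)) (cong (range 1 (X k) ++_) (range-∷ʳ (suc (X k)) d))) ⟩
    map fill (range 1 (X k) ++ (range (suc (X k)) d ++ [ suc (X k) + d ]))
      ≡⟨ trans (List.map-++ fill (range 1 (X k)) _)
           (cong (map fill (range 1 (X k)) ++_) (List.map-++ fill (range (suc (X k)) d) _)) ⟩
    map fill (range 1 (X k)) ++ (map fill (range (suc (X k)) d) ++ [ fill (suc (X k) + d) ])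
      ≡⟨ cong (λ l → map fill (range 1 (X k)) ++ (l ++ [ fill (suc (X k) + d) ]))
           (fill-range k d (<⇒≤ k<m) (λ _ → ≤-reflexive end≡)) ⟩
    map fill (range 1 (X k)) ++ (range (suc (H k)) d ++ [ fill (suc (X k) + d) ])
      ≡⟨ cong (λ x → map fill (range 1 (X k)) ++ (range (suc (H k)) d ++ [ x ]))
           (trans (cong fill end≡) (fill-anchor (suc k) k<m)) ⟩
    map fill (range 1 (X k)) ++ (range (suc (H k)) d ++ [ H (suc k) ]) ∎
    where
    open ≡-Reasoning
    d = X (suc k) ∸ X k ∸ 1
    Xk+1+d≡ : X k + suc d ≡ X (suc k)
    Xk+1+d≡ = trans (cong (X k +_) (sym (m<n⇒n∸m≡1+[n∸m∸1] (X-step k k<m)))) (m+[n∸m]≡n (<⇒≤ (X-step k k<m)))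
    end≡ : suc (X k) + d ≡ X (suc k)
    end≡ = trans (sym (+-suc (X k) d)) Xk+1+d≡

  map-fill-last : ∀ e → map fill (range 1 (X m + e)) ≡ map fill (range 1 (X m)) ++ range (suc (H m)) e
  map-fill-last e = trans (cong (map fill) (range-++ 1 (X m) e))
    (trans (List.map-++ fill (range 1 (X m)) _)
      (cong (map fill (range 1 (X m)) ++_) (fill-range m e ≤-refl (λ m<m → ⊥-elim (<-irrefl refl m<m)))))

-- The extended permutation

IsOccAt-≡ : ∀ {p w o u v} → IsOccAt p w o → u < length p → v < length p →
  at p u ≡ at p v → at w (o + u) ≡ at w (o + v)
IsOccAt-≡ {w = w} {o} {u} {v} occ u<ℓ v<ℓ pu≡pv with <-cmp (at w (o + u)) (at w (o + v))
... | tri≈ _ wu≡wv _ = wu≡wv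
... | tri< wu<wv _ _ = ⊥-elim (<-irrefl pu≡pv (Equivalence.to (occ u v u<ℓ v<ℓ) wu<wv))
... | tri> _ _ wv<wu = ⊥-elim (<-irrefl (sym pu≡pv) (Equivalence.to (occ v u v<ℓ u<ℓ) wv<wu))

module Extension (p : List ℕ) (pat : IsPattern p) (t′ : ℕ) (i≤ℓ : suc (suc t′) ≤ length p)
  {w₀ : List ℕ} (w₀-occ₀ : IsOccAt p w₀ 0) (w₀-occₜ : IsOccAt p w₀ (suc t′))
  (σ : ℕ → ℕ) (σ-sorts : IsSortingPerm p (suc (suc t′)) σ) where

  ℓ i t m n : ℕ
  ℓ = length p
  i = suc (suc t′)
  t = suc t′
  m = ℓ + 1 ∸ i
  n = ℓ + i ∸ 1

  t≤ℓ : t ≤ ℓ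
  t≤ℓ = <⇒≤ i≤ℓ

  m≡ℓ∸t : m ≡ ℓ ∸ t
  m≡ℓ∸t = cong (_∸ i) (+-comm ℓ 1)

  t+m≡ℓ : t + m ≡ ℓ
  t+m≡ℓ = trans (cong (t +_) m≡ℓ∸t) (m+[n∸m]≡n t≤ℓ)

  n≡ℓ+t : n ≡ ℓ + t
  n≡ℓ+t = cong (_∸ 1) (+-suc ℓ t)

  1≤m : 1 ≤ m
  1≤m = subst (1 ≤_) (sym m≡ℓ∸t) (m<n⇒0<n∸m i≤ℓ)

  m≤ℓ : m ≤ ℓ
  m≤ℓ = subst (m ≤_) t+m≡ℓ (m≤n+m m t)

  p↭1…ℓ : p ↭ range 1 ℓ
  p↭1…ℓ = subst (p ↭_) (map-suc-upTo ℓ) pat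

  at-p-bounds : ∀ k → k < ℓ → 1 ≤ at p k × at p k ≤ ℓ
  at-p-bounds k k<ℓ with ∈-range⁻ 1 ℓ (∈-resp-↭ p↭1…ℓ (at-∈ p k k<ℓ))
  ... | 1≤x , s≤s x≤ℓ = 1≤x , x≤ℓ

  ∈-p : ∀ r → 1 ≤ r → r ≤ ℓ → r ∈ p
  ∈-p r 1≤r r≤ℓ = ∈-resp-↭ (↭-sym p↭1…ℓ) (∈-range⁺ 1 ℓ 1≤r (s≤s r≤ℓ))

  -- Positions t + u and u of p sit at the same place of w₀, so they are ordered alike.
  overlap-order : ∀ u v → u < m → v < m → at p u < at p v → at p (t + u) < at p (t + v)
  overlap-order u v u<m v<m pu<pv = Equivalence.to (w₀-occ₀ (t + u) (t + v) (shift-< u<m) (shift-< v<m))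
    (Equivalence.from (w₀-occₜ u v (<-≤-trans u<m m≤ℓ) (<-≤-trans v<m m≤ℓ)) pu<pv)
    where
    shift-< : ∀ {u} → u < m → t + u < ℓ
    shift-< u<m = subst (t + _ <_) t+m≡ℓ (+-monoʳ-< t u<m)

  -- σ as a map to 0-based positions of p.
  q : ℕ → ℕ
  q j = pred (σ j)

  σ≡1+q : ∀ j → 1 ≤ j → j ≤ m → σ j ≡ suc (q j)
  σ≡1+q j 1≤j j≤m with σ j | proj₁ σ-sorts j 1≤j j≤m
  ... | suc _ | _ = refl

  q<m : ∀ j → 1 ≤ j → j ≤ m → q j < m
  q<m j 1≤j j≤m = subst (_≤ m) (σ≡1+q j 1≤j j≤m) (proj₂ (proj₁ σ-sorts j 1≤j j≤m))

  q<ℓ : ∀ j → 1 ≤ j → j ≤ m → q j < ℓ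
  q<ℓ j 1≤j j≤m = <-≤-trans (q<m j 1≤j j≤m) m≤ℓ

  t+q<ℓ : ∀ j → 1 ≤ j → j ≤ m → t + q j < ℓ
  t+q<ℓ j 1≤j j≤m = subst (t + q j <_) t+m≡ℓ (+-monoʳ-< t (q<m j 1≤j j≤m))

  q-permutes : map q (range 1 m) ↭ range 0 m
  q-permutes = Unique⊆⇒↭ (Unique-map⁺-on q-injective unique-1…m) ⊆0…m
    (trans (List.length-map q (range 1 m)) (trans (length-range 1 m) (sym (length-range 0 m))))
    where
    unique-1…m : Unique (range 1 m)
    unique-1…m = subst Unique (map-suc-upTo m) (Unique-map⁺ suc-injective (upTo⁺ m))
    q-injective : ∀ {a b} → a ∈ range 1 m → b ∈ range 1 m → q a ≡ q b → a ≡ b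
    q-injective a∈ b∈ qa≡qb with ∈-range⁻ 1 m a∈ | ∈-range⁻ 1 m b∈
    ... | 1≤a , s≤s a≤m | 1≤b , s≤s b≤m = proj₁ (proj₂ σ-sorts) _ _ 1≤a a≤m 1≤b b≤m
      (trans (σ≡1+q _ 1≤a a≤m) (trans (cong suc qa≡qb) (sym (σ≡1+q _ 1≤b b≤m))))
    ⊆0…m : ∀ {y} → y ∈ map q (range 1 m) → y ∈ range 0 m
    ⊆0…m y∈ with ∈-map⁻ q y∈
    ... | s , s∈ , refl with ∈-range⁻ 1 m s∈
    ...   | 1≤s , s≤s s≤m = ∈-range⁺ 0 m z≤n (q<m s 1≤s s≤m)

  q-surjective : ∀ j → j < m → Σ[ s ∈ ℕ ] 1 ≤ s × s ≤ m × q s ≡ j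
  q-surjective j j<m with ∈-map⁻ q (∈-resp-↭ (↭-sym q-permutes) (∈-range⁺ 0 m z≤n j<m))
  ... | s , s∈ , j≡qs with ∈-range⁻ 1 m s∈
  ...   | 1≤s , s≤s s≤m = s , 1≤s , s≤m , sym j≡qs

  -- The values of p at σ(j) + i − 1 (first copy) and at σ(j) (second copy): the ranks in
  -- the two copies of the j-th smallest overlap letter.
  A B : ℕ → ℕ
  A zero    = 0
  A (suc j) = P p (σ (suc j) + i ∸ 1)
  B zero    = 0
  B (suc j) = P p (σ (suc j))

  A≡at : ∀ j → 1 ≤ j → j ≤ m → A j ≡ at p (t + q j)
  A≡at (suc j) 1≤j j≤m rewrite σ≡1+q (suc j) 1≤j j≤m =
    cong (at p) (trans (cong (_∸ 1) (+-suc (q (suc j)) t)) (+-comm (q (suc j)) t))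

  B≡at : ∀ j → 1 ≤ j → j ≤ m → B j ≡ at p (q j)
  B≡at (suc j) 1≤j j≤m rewrite σ≡1+q (suc j) 1≤j j≤m = refl

  A-bounds : ∀ j → 1 ≤ j → j ≤ m → 1 ≤ A j × A j ≤ ℓ
  A-bounds j 1≤j j≤m rewrite A≡at j 1≤j j≤m = at-p-bounds (t + q j) (t+q<ℓ j 1≤j j≤m)

  B-bounds : ∀ j → 1 ≤ j → j ≤ m → 1 ≤ B j × B j ≤ ℓ
  B-bounds j 1≤j j≤m rewrite B≡at j 1≤j j≤m = at-p-bounds (q j) (q<ℓ j 1≤j j≤m)

  B-step : ∀ j → j < m → B j < B (suc j)
  B-step zero    0<m = proj₁ (B-bounds 1 ≤-refl 0<m)
  B-step (suc j) j<m = proj₂ (proj₂ σ-sorts) (suc j) (s≤s z≤n) j<m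

  A-step : ∀ j → j < m → A j < A (suc j)
  A-step zero    0<m = proj₁ (A-bounds 1 ≤-refl 0<m)
  A-step (suc j) j<m = subst₂ _<_ (sym (A≡at (suc j) (s≤s z≤n) (<⇒≤ j<m))) (sym (A≡at (suc (suc j)) (s≤s z≤n) j<m))
    (overlap-order _ _ (q<m (suc j) (s≤s z≤n) (<⇒≤ j<m)) (q<m (suc (suc j)) (s≤s z≤n) j<m)
      (subst₂ _<_ (B≡at (suc j) (s≤s z≤n) (<⇒≤ j<m)) (B≡at (suc (suc j)) (s≤s z≤n) j<m) (B-step (suc j) j<m)))

  δ¹-inner : ∀ k → k < m → δ¹ p i σ (suc k) ≡ B (suc k) ∸ B k ∸ 1
  δ¹-inner zero    _   = refl
  δ¹-inner (suc k) k<m with suc (suc k) ≡ᵇ suc m | ≢⇒≡ᵇ≡false (<⇒≢ (s≤s k<m))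
  ... | false | _ = refl

  δ²-inner : ∀ k → k < m → δ² p i σ (suc k) ≡ A (suc k) ∸ A k ∸ 1
  δ²-inner zero    _   = refl
  δ²-inner (suc k) k<m with suc (suc k) ≡ᵇ suc m | ≢⇒≡ᵇ≡false (<⇒≢ (s≤s k<m))
  ... | false | _ = refl

  private
    1+m≢1 : suc m ≢ 1
    1+m≢1 1+m≡1 = <⇒≢ 1≤m (sym (suc-injective 1+m≡1))

    B≡P : ∀ j → 1 ≤ j → B j ≡ P p (σ j)
    B≡P (suc j) _ = refl

    A≡P : ∀ j → 1 ≤ j → A j ≡ P p (σ j + i ∸ 1)
    A≡P (suc j) _ = refl

  δ¹-last : δ¹ p i σ (suc m) ≡ ℓ ∸ B m
  δ¹-last with suc m ≡ᵇ 1 | ≢⇒≡ᵇ≡false 1+m≢1 | suc m ≡ᵇ suc m | ≡ᵇ-refl m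
  ... | false | _ | true | _ = cong (ℓ ∸_) (sym (B≡P m 1≤m))

  δ²-last : δ² p i σ (suc m) ≡ ℓ ∸ A m
  δ²-last with suc m ≡ᵇ 1 | ≢⇒≡ᵇ≡false 1+m≢1 | suc m ≡ᵇ suc m | ≡ᵇ-refl m
  ... | false | _ | true | _ = cong (ℓ ∸_) (sym (A≡P m 1≤m))

  block-inner : ∀ k → k < m → block p i σ (suc k) ≡ gapBlock (δ¹ p i σ (suc k)) (δ² p i σ (suc k)) 1
  block-inner k k<m with suc k ≡ᵇ suc m | ≢⇒≡ᵇ≡false (<⇒≢ (s≤s k<m))
  ... | false | _ = refl

  block-last : block p i σ (suc m) ≡ gapBlock (δ¹ p i σ (suc m)) (δ² p i σ (suc m)) 0
  block-last with suc m ≡ᵇ suc m | ≡ᵇ-refl m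
  ... | true | _ = refl

  A-gap : ∀ j → j < m → A (suc j) ∸ A j ≡ suc (δ² p i σ (suc j))
  A-gap j j<m = trans (m<n⇒n∸m≡1+[n∸m∸1] (A-step j j<m)) (cong suc (sym (δ²-inner j j<m)))

  B-gap : ∀ j → j < m → B (suc j) ∸ B j ≡ suc (δ¹ p i σ (suc j))
  B-gap j j<m = trans (m<n⇒n∸m≡1+[n∸m∸1] (B-step j j<m)) (cong suc (sym (δ¹-inner j j<m)))

  -- H j is the j-th smallest overlap letter of the extended permutation.
  H : ℕ → ℕ
  H zero    = 0
  H (suc j) = H j + suc (δ¹ p i σ (suc j) ⊔ δ² p i σ (suc j))

  H-climbs-A : ∀ j → j < m → H j + (A (suc j) ∸ A j) ≤ H (suc j)
  H-climbs-A j j<m = +-monoʳ-≤ (H j) (subst (_≤ suc (δ¹ p i σ (suc j) ⊔ δ² p i σ (suc j))) (sym (A-gap j j<m))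
    (s≤s (m≤n⊔m (δ¹ p i σ (suc j)) _)))

  H-climbs-B : ∀ j → j < m → H j + (B (suc j) ∸ B j) ≤ H (suc j)
  H-climbs-B j j<m = +-monoʳ-≤ (H j) (subst (_≤ suc (δ¹ p i σ (suc j) ⊔ δ² p i σ (suc j))) (sym (B-gap j j<m))
    (s≤s (m≤m⊔n _ (δ² p i σ (suc j)))))

  -- First.fill r and Second.fill r are the letters of the extended permutation at the positions where
  -- the first resp. second copy of p has the letter r.
  module First  = Staircase A H refl refl A-step H-climbs-A
  module Second = Staircase B H refl refl B-step H-climbs-B

  fill-overlap : ∀ j → j < m → First.fill (at p (t + j)) ≡ Second.fill (at p j)
  fill-overlap j j<m with q-surjective j j<m
  ... | s , 1≤s , s≤m , refl = begin
    First.fill (at p (t + q s))  ≡⟨ cong First.fill (A≡at s 1≤s s≤m) ⟨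
    First.fill (A s)             ≡⟨ First.fill-anchor s s≤m ⟩
    H s                          ≡⟨ Second.fill-anchor s s≤m ⟨
    Second.fill (B s)            ≡⟨ cong Second.fill (B≡at s 1≤s s≤m) ⟩
    Second.fill (at p (q s))     ∎
    where open ≡-Reasoning

  h : ℕ → ℕ
  h k with k <? ℓ
  ... | yes _ = First.fill (at p k)
  ... | no _  = Second.fill (at p (k ∸ t))

  h-first : ∀ k → k < ℓ → h k ≡ First.fill (at p k)
  h-first k k<ℓ with k <? ℓ
  ... | yes _   = refl
  ... | no k≮ℓ = ⊥-elim (k≮ℓ k<ℓ)

  h-second : ∀ j → j < ℓ → h (t + j) ≡ Second.fill (at p j)
  h-second j j<ℓ with t + j <? ℓ
  ... | yes t+j<ℓ = fill-overlap j (+-cancelˡ-< t j m (subst (t + j <_) (sym t+m≡ℓ) t+j<ℓ))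
  ... | no _      = cong (λ k → Second.fill (at p k)) (m+n∸m≡n t j)

  W : List ℕ
  W = map h (range 0 n)

  length-W : length W ≡ n
  length-W = trans (List.length-map h (range 0 n)) (length-range 0 n)

  at-W : ∀ k → k < n → at W k ≡ h k
  at-W k = at-map-range h 0 n k

  ℓ≤n : ℓ ≤ n
  ℓ≤n = subst (ℓ ≤_) (sym n≡ℓ+t) (m≤m+n ℓ t)

  t+ℓ≤n : t + ℓ ≤ n
  t+ℓ≤n = ≤-reflexive (trans (+-comm t ℓ) (sym n≡ℓ+t))

  ∸t<ℓ : ∀ k → k < n → ¬ k < ℓ → k ∸ t < ℓ
  ∸t<ℓ k k<n k≮ℓ = subst (k ∸ t <_) (m+n∸n≡m ℓ t) (∸-monoˡ-< (subst (k <_) n≡ℓ+t k<n) (≤-trans t≤ℓ (≮⇒≥ k≮ℓ)))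

  1≤h : ∀ k → k < n → 1 ≤ h k
  1≤h k k<n with k <? ℓ
  ... | yes k<ℓ = ≤-trans (proj₁ (at-p-bounds k k<ℓ)) (First.≤-fill _)
  ... | no k≮ℓ  = ≤-trans (proj₁ (at-p-bounds (k ∸ t) (∸t<ℓ k k<n k≮ℓ))) (Second.≤-fill _)

  W-overlaps : IsOverlapWord p i W
  W-overlaps = length-W , All.tabulate positive , occ₀ , occₜ
    where
    positive : ∀ {y} → y ∈ W → 1 ≤ y
    positive y∈W with ∈-map⁻ h y∈W
    ... | k , k∈ , refl = 1≤h k (proj₂ (∈-range⁻ 0 n k∈))
    occ₀ : IsOccAt p W 0
    occ₀ j k j<ℓ k<ℓ = subst₂ (λ x y → (x < y) ⇔ (at p j < at p k))
      (sym (trans (at-W j (<-≤-trans j<ℓ ℓ≤n)) (h-first j j<ℓ)))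
      (sym (trans (at-W k (<-≤-trans k<ℓ ℓ≤n)) (h-first k k<ℓ)))
      (strictMono⇒<⇔< First.fill First.fill-strictMono (at p j) (at p k))
    occₜ : IsOccAt p W t
    occₜ j k j<ℓ k<ℓ = subst₂ (λ x y → (x < y) ⇔ (at p j < at p k))
      (sym (trans (at-W (t + j) (<-≤-trans (+-monoʳ-< t j<ℓ) t+ℓ≤n)) (h-second j j<ℓ)))
      (sym (trans (at-W (t + k) (<-≤-trans (+-monoʳ-< t k<ℓ) t+ℓ≤n)) (h-second k k<ℓ)))
      (strictMono⇒<⇔< Second.fill Second.fill-strictMono (at p j) (at p k))

  module Least {f : List ℕ} (|f|≡n : length f ≡ n) (f-positive : All (λ x → 1 ≤ x) f)
    (f-occ₀ : IsOccAt p f 0) (f-occₜ : IsOccAt p f t) where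

    -- F o r is the letter of f in the position of the letter r of the occurrence of p at offset o
    -- (with F o 0 = 0 below every letter).
    F : ℕ → ℕ → ℕ
    F o zero    = 0
    F o (suc r) = at f (o + indexOf p (suc r))

    private
      indexOf-p : ∀ r → r < ℓ → indexOf p (suc r) < ℓ × at p (indexOf p (suc r)) ≡ suc r
      indexOf-p r r<ℓ = indexOf-spec p (∈-p (suc r) (s≤s z≤n) r<ℓ)

    F-at : ∀ {o} → IsOccAt p f o → ∀ k → k < ℓ → F o (at p k) ≡ at f (o + k)
    F-at {o} occ k k<ℓ with at p k in pk≡ | at-p-bounds k k<ℓ
    ... | suc r | _ , r<ℓ =
      IsOccAt-≡ {p} {f} {o} occ (proj₁ (indexOf-p r r<ℓ)) k<ℓ (trans (proj₂ (indexOf-p r r<ℓ)) (sym pk≡))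

    F-step : ∀ {o} → IsOccAt p f o → o + ℓ ≤ n → ∀ r → r < ℓ → F o r < F o (suc r)
    F-step {o} occ o+ℓ≤n zero 0<ℓ = All.lookup f-positive (at-∈ f _ (subst (o + indexOf p 1 <_) (sym |f|≡n)
      (<-≤-trans (+-monoʳ-< o (proj₁ (indexOf-p 0 0<ℓ))) o+ℓ≤n)))
    F-step occ o+ℓ≤n (suc r) r<ℓ with indexOf-p r (<⇒≤ r<ℓ) | indexOf-p (suc r) r<ℓ
    ... | idx<ℓ , p[idx]≡1+r | idx′<ℓ , p[idx′]≡2+r =
      Equivalence.from (occ _ _ idx<ℓ idx′<ℓ) (subst₂ _<_ (sym p[idx]≡1+r) (sym p[idx′]≡2+r) ≤-refl)

    F₀-step : ∀ r → r < ℓ → F 0 r < F 0 (suc r)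
    F₀-step = F-step f-occ₀ ℓ≤n

    Fₜ-step : ∀ r → r < ℓ → F t r < F t (suc r)
    Fₜ-step = F-step f-occₜ t+ℓ≤n

    F₀A≡FₜB : ∀ k → k ≤ m → F 0 (A k) ≡ F t (B k)
    F₀A≡FₜB zero    _   = refl
    F₀A≡FₜB (suc k) k<m = begin
      F 0 (A (suc k))            ≡⟨ cong (F 0) (A≡at (suc k) (s≤s z≤n) k<m) ⟩
      F 0 (at p (t + q (suc k))) ≡⟨ F-at f-occ₀ _ (t+q<ℓ (suc k) (s≤s z≤n) k<m) ⟩
      at f (t + q (suc k))       ≡⟨ F-at f-occₜ _ (q<ℓ (suc k) (s≤s z≤n) k<m) ⟨
      F t (at p (q (suc k)))     ≡⟨ cong (F t) (B≡at (suc k) (s≤s z≤n) k<m) ⟨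
      F t (B (suc k))            ∎
      where open ≡-Reasoning

    -- Both copies force every overlap letter of f to clear the previous one by the larger gap.
    H≤F₀A : ∀ k → k ≤ m → H k ≤ F 0 (A k)
    H≤F₀A zero    _   = z≤n
    H≤F₀A (suc k) k<m = begin
      H k + suc (δ¹ p i σ (suc k) ⊔ δ² p i σ (suc k))
        ≡⟨ +-distribˡ-⊔ (H k) (suc (δ¹ p i σ (suc k))) (suc (δ² p i σ (suc k))) ⟩
      (H k + suc (δ¹ p i σ (suc k))) ⊔ (H k + suc (δ² p i σ (suc k)))
        ≡⟨ cong₂ (λ a b → (H k + a) ⊔ (H k + b)) (B-gap k k<m) (A-gap k k<m) ⟨
      (H k + (B (suc k) ∸ B k)) ⊔ (H k + (A (suc k) ∸ A k))
        ≤⟨ ⊔-lub (subst (_ ≤_) (sym (F₀A≡FₜB (suc k) k<m))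
                   (climb (F t) B Fₜ-step B-step B-bounds (subst (H k ≤_) (F₀A≡FₜB k (<⇒≤ k<m)) ih)))
                 (climb (F 0) A F₀-step A-step A-bounds ih) ⟩
      F 0 (A (suc k)) ∎
      where
      open ≤-Reasoning
      ih = H≤F₀A k (<⇒≤ k<m)
      climb : ∀ (G X : ℕ → ℕ) → (∀ r → r < ℓ → G r < G (suc r)) → (∀ j → j < m → X j < X (suc j)) →
        (∀ j → 1 ≤ j → j ≤ m → 1 ≤ X j × X j ≤ ℓ) → H k ≤ G (X k) → H k + (X (suc k) ∸ X k) ≤ G (X (suc k))
      climb G X G-step X-step X-bounds Hk≤ = ≤-trans (+-monoˡ-≤ _ Hk≤)
        (strictMono-gap G G-step (<⇒≤ (X-step k k<m)) (proj₂ (X-bounds (suc k) (s≤s z≤n) k<m)))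

    h≤f : ∀ k → k < n → h k ≤ at f k
    h≤f k k<n with k <? ℓ
    ... | yes k<ℓ = subst (First.fill (at p k) ≤_) (F-at f-occ₀ k k<ℓ)
      (First.fill-least (F 0) F₀-step H≤F₀A (at p k) (proj₂ (at-p-bounds k k<ℓ)))
    ... | no k≮ℓ = subst (Second.fill (at p (k ∸ t)) ≤_) (trans (F-at f-occₜ _ j<ℓ) (cong (at f) (m+[n∸m]≡n t≤k)))
      (Second.fill-least (F t) Fₜ-step H≤FₜB (at p (k ∸ t)) (proj₂ (at-p-bounds (k ∸ t) j<ℓ)))
      where
      j<ℓ = ∸t<ℓ k k<n k≮ℓ
      t≤k = ≤-trans t≤ℓ (≮⇒≥ k≮ℓ)
      H≤FₜB : ∀ j → j ≤ m → H j ≤ F t (B j)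
      H≤FₜB j j≤m = subst (H j ≤_) (F₀A≡FₜB j j≤m) (H≤F₀A j j≤m)

  W-least : ∀ f → IsOverlapWord p i f → LexLe W f
  W-least f (|f|≡n , f-positive , f-occ₀ , f-occₜ) = pointwise≤⇒LexLe W f (trans length-W (sym |f|≡n))
    λ k k<|W| → let k<n = subst (k <_) length-W k<|W| in
      subst (_≤ at f k) (sym (at-W k k<n)) (Least.h≤f |f|≡n f-positive f-occ₀ f-occₜ k k<n)

  blocksUpTo : ℕ → List ℕ
  blocksUpTo k = concatMap (block p i σ) (range 1 k)

  blocksUpTo-suc : ∀ k → blocksUpTo (suc k) ≡ blocksUpTo k ++ block p i σ (suc k)
  blocksUpTo-suc k = trans (cong (concatMap (block p i σ)) (range-∷ʳ 1 k))
    (trans (List.concatMap-++ (block p i σ) (range 1 k) [ suc k ])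
      (cong (blocksUpTo k ++_) (List.++-identityʳ (block p i σ (suc k)))))

  length-blocksUpTo : ∀ k → k ≤ m → length (blocksUpTo k) ≡ H k
  length-blocksUpTo zero    _   = refl
  length-blocksUpTo (suc k) k<m = begin
    length (blocksUpTo (suc k))                         ≡⟨ cong length (blocksUpTo-suc k) ⟩
    length (blocksUpTo k ++ block p i σ (suc k))        ≡⟨ List.length-++ (blocksUpTo k) ⟩
    length (blocksUpTo k) + length (block p i σ (suc k)) ≡⟨ cong₂ _+_ (length-blocksUpTo k (<⇒≤ k<m))
                                                            (cong length (block-inner k k<m)) ⟩
    H k + length (gapBlock d₁ d₂ 1)                     ≡⟨ cong (H k +_) (length-gapBlock d₁ d₂ 1) ⟩
    H k + (d₁ ⊔ d₂ + 1)                                 ≡⟨ cong (H k +_) (+-comm (d₁ ⊔ d₂) 1) ⟩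
    H (suc k)                                           ∎
    where
    open ≡-Reasoning
    d₁ = δ¹ p i σ (suc k)
    d₂ = δ² p i σ (suc k)

  Mfrom-blocksUpTo-suc : ∀ k → k ≤ m →
    Mfrom 0 (blocksUpTo (suc k)) ≡ Mfrom 0 (blocksUpTo k) ++ Mfrom (H k) (block p i σ (suc k))
  Mfrom-blocksUpTo-suc k k≤m = trans (cong (Mfrom 0) (blocksUpTo-suc k))
    (trans (Mfrom-++ 0 (blocksUpTo k) _)
      (cong (λ o → Mfrom 0 (blocksUpTo k) ++ Mfrom o (block p i σ (suc k))) (length-blocksUpTo k k≤m)))

  -- Block k + 1 consists of the letters strictly between H k and H (k + 1) in either copy, and H (k + 1).
  block-inner-letters : ∀ k → k < m → Mfrom (H k) (block p i σ (suc k)) ↭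
    (range (suc (H k)) (B (suc k) ∸ B k ∸ 1) ++ range (suc (H k)) (A (suc k) ∸ A k ∸ 1)) ++ [ H (suc k) ]
  block-inner-letters k k<m = begin
    Mfrom (H k) (block p i σ (suc k))
      ≡⟨ cong (Mfrom (H k)) (block-inner k k<m) ⟩
    Mfrom (H k) (gapBlock d₁ d₂ 1)
      ↭⟨ Mfrom-gapBlock (H k) d₁ d₂ 1 ⟩
    (range (suc (H k)) d₁ ++ range (suc (H k)) d₂) ++ [ suc (H k + (d₁ ⊔ d₂)) ]
      ≡⟨ cong (λ x → (range (suc (H k)) d₁ ++ range (suc (H k)) d₂) ++ [ x ]) (+-suc (H k) (d₁ ⊔ d₂)) ⟨
    (range (suc (H k)) d₁ ++ range (suc (H k)) d₂) ++ [ H (suc k) ]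
      ≡⟨ cong₂ (λ a b → (range (suc (H k)) a ++ range (suc (H k)) b) ++ [ H (suc k) ])
           (δ¹-inner k k<m) (δ²-inner k k<m) ⟩
    (range (suc (H k)) (B (suc k) ∸ B k ∸ 1) ++ range (suc (H k)) (A (suc k) ∸ A k ∸ 1)) ++ [ H (suc k) ] ∎
    where
    open PermutationReasoning
    d₁ = δ¹ p i σ (suc k)
    d₂ = δ² p i σ (suc k)

  block-last-letters : Mfrom (H m) (block p i σ (suc m)) ↭ range (suc (H m)) (ℓ ∸ B m) ++ range (suc (H m)) (ℓ ∸ A m)
  block-last-letters = begin
    Mfrom (H m) (block p i σ (suc m))  ≡⟨ cong (Mfrom (H m)) block-last ⟩
    Mfrom (H m) (gapBlock d₁ d₂ 0)     ↭⟨ Mfrom-gapBlock (H m) d₁ d₂ 0 ⟩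
    (range (suc (H m)) d₁ ++ range (suc (H m)) d₂) ++ []
                                       ≡⟨ List.++-identityʳ _ ⟩
    range (suc (H m)) d₁ ++ range (suc (H m)) d₂
                                       ≡⟨ cong₂ (λ a b → range (suc (H m)) a ++ range (suc (H m)) b) δ¹-last δ²-last ⟩
    range (suc (H m)) (ℓ ∸ B m) ++ range (suc (H m)) (ℓ ∸ A m) ∎
    where
    open PermutationReasoning
    d₁ = δ¹ p i σ (suc m)
    d₂ = δ² p i σ (suc m)

  blocks-balance : ∀ k → k ≤ m → Mfrom 0 (blocksUpTo k) ++ map H (range 1 k) ↭
    map Second.fill (range 1 (B k)) ++ map First.fill (range 1 (A k))
  blocks-balance zero    _   = ↭-refl
  blocks-balance (suc k) k<m = begin
    Mfrom 0 (blocksUpTo (suc k)) ++ map H (range 1 (suc k))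
      ≡⟨ cong₂ _++_ (Mfrom-blocksUpTo-suc k (<⇒≤ k<m))
           (trans (cong (map H) (range-∷ʳ 1 k)) (List.map-++ H (range 1 k) [ suc k ])) ⟩
    (Mk ++ Mfrom (H k) (block p i σ (suc k))) ++ (Hs ++ [ x ])
      ↭⟨ ++-interchange Mk _ Hs [ x ] ⟩
    (Mk ++ Hs) ++ (Mfrom (H k) (block p i σ (suc k)) ++ [ x ])
      ↭⟨ ++⁺ (blocks-balance k (<⇒≤ k<m)) new-letters ⟩
    (G₂ ++ G₁) ++ ((R₁ ++ [ x ]) ++ (R₂ ++ [ x ]))
      ↭⟨ ++-interchange G₂ G₁ (R₁ ++ [ x ]) (R₂ ++ [ x ]) ⟩
    (G₂ ++ (R₁ ++ [ x ])) ++ (G₁ ++ (R₂ ++ [ x ]))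
      ≡⟨ cong₂ _++_ (Second.map-fill-next k k<m) (First.map-fill-next k k<m) ⟨
    map Second.fill (range 1 (B (suc k))) ++ map First.fill (range 1 (A (suc k))) ∎
    where
    open PermutationReasoning
    x = H (suc k)
    Mk = Mfrom 0 (blocksUpTo k)
    Hs = map H (range 1 k)
    G₂ = map Second.fill (range 1 (B k))
    G₁ = map First.fill (range 1 (A k))
    R₁ = range (suc (H k)) (B (suc k) ∸ B k ∸ 1)
    R₂ = range (suc (H k)) (A (suc k) ∸ A k ∸ 1)
    new-letters : Mfrom (H k) (block p i σ (suc k)) ++ [ x ] ↭ (R₁ ++ [ x ]) ++ (R₂ ++ [ x ])
    new-letters = ↭-trans (++⁺ʳ [ x ] (block-inner-letters k k<m))
      (↭-trans (++-assoc (R₁ ++ R₂) [ x ] [ x ]) (++-interchange R₁ R₂ [ x ] [ x ]))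

  extMultiplicities-balance : Mfrom 0 (extMultiplicities p i σ) ++ map H (range 1 m) ↭
    map Second.fill (range 1 ℓ) ++ map First.fill (range 1 ℓ)
  extMultiplicities-balance = begin
    Mfrom 0 (extMultiplicities p i σ) ++ map H (range 1 m)
      ≡⟨ cong (λ js → Mfrom 0 (concatMap (block p i σ) js) ++ map H (range 1 m)) (map-suc-upTo (suc m)) ⟩
    Mfrom 0 (blocksUpTo (suc m)) ++ map H (range 1 m)
      ≡⟨ cong₂ _++_ (Mfrom-blocksUpTo-suc m ≤-refl) (sym (List.++-identityʳ Hs)) ⟩
    (Mm ++ Mfrom (H m) (block p i σ (suc m))) ++ (Hs ++ [])
      ↭⟨ ++-interchange Mm _ Hs [] ⟩
    (Mm ++ Hs) ++ (Mfrom (H m) (block p i σ (suc m)) ++ [])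
      ↭⟨ ++⁺ (blocks-balance m ≤-refl) (↭-trans (↭-reflexive (List.++-identityʳ _)) block-last-letters) ⟩
    (G₂ ++ G₁) ++ (R₁ ++ R₂)
      ↭⟨ ++-interchange G₂ G₁ R₁ R₂ ⟩
    (G₂ ++ R₁) ++ (G₁ ++ R₂)
      ≡⟨ cong₂ _++_ (Second.map-fill-last (ℓ ∸ B m)) (First.map-fill-last (ℓ ∸ A m)) ⟨
    map Second.fill (range 1 (B m + (ℓ ∸ B m))) ++ map First.fill (range 1 (A m + (ℓ ∸ A m)))
      ≡⟨ cong₂ (λ a b → map Second.fill (range 1 a) ++ map First.fill (range 1 b))
           (m+[n∸m]≡n (proj₂ (B-bounds m 1≤m ≤-refl))) (m+[n∸m]≡n (proj₂ (A-bounds m 1≤m ≤-refl))) ⟩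
    map Second.fill (range 1 ℓ) ++ map First.fill (range 1 ℓ) ∎
    where
    open PermutationReasoning
    Mm = Mfrom 0 (blocksUpTo m)
    Hs = map H (range 1 m)
    G₂ = map Second.fill (range 1 (B m))
    G₁ = map First.fill (range 1 (A m))
    R₁ = range (suc (H m)) (ℓ ∸ B m)
    R₂ = range (suc (H m)) (ℓ ∸ A m)

  map-via-at : ∀ (g : ℕ → ℕ) → map g p ≡ map (λ k → g (at p k)) (range 0 ℓ)
  map-via-at g = trans (cong (map g) (sym (map-at-range p))) (sym (List.map-∘ (range 0 ℓ)))

  h-second-range : ∀ c → c ≤ ℓ → map h (range t c) ≡ map (λ j → Second.fill (at p j)) (range 0 c)
  h-second-range c c≤ℓ = trans (cong (λ o → map h (range o c)) (sym (+-identityʳ t)))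
    (trans (map-range-+ h t 0 c) (map-cong-range _ _ 0 c (λ j j<c → h-second j (<-≤-trans j<c c≤ℓ))))

  first-copy : map First.fill p ≡ map h (range 0 ℓ)
  first-copy = trans (map-via-at First.fill) (map-cong-range _ h 0 ℓ (λ k k<ℓ → sym (h-first k k<ℓ)))

  second-copy : map Second.fill p ≡ map h (range t m) ++ map h (range ℓ t)
  second-copy = begin
    map Second.fill p                             ≡⟨ map-via-at Second.fill ⟩
    map (λ j → Second.fill (at p j)) (range 0 ℓ)  ≡⟨ h-second-range ℓ ≤-refl ⟨
    map h (range t ℓ)                             ≡⟨ cong (λ c → map h (range t c)) (trans (+-comm m t) t+m≡ℓ) ⟨
    map h (range t (m + t))                       ≡⟨ cong (map h) (range-++ t m t) ⟩
    map h (range t m ++ range (t + m) t)          ≡⟨ List.map-++ h (range t m) _ ⟩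
    map h (range t m) ++ map h (range (t + m) t)  ≡⟨ cong (λ o → map h (range t m) ++ map h (range o t)) t+m≡ℓ ⟩
    map h (range t m) ++ map h (range ℓ t)        ∎
    where open ≡-Reasoning

  W-split : W ≡ map h (range 0 ℓ) ++ map h (range ℓ t)
  W-split = begin
    map h (range 0 n)                       ≡⟨ cong (λ c → map h (range 0 c)) n≡ℓ+t ⟩
    map h (range 0 (ℓ + t))                 ≡⟨ cong (map h) (range-++ 0 ℓ t) ⟩
    map h (range 0 ℓ ++ range ℓ t)          ≡⟨ List.map-++ h (range 0 ℓ) (range ℓ t) ⟩
    map h (range 0 ℓ) ++ map h (range ℓ t)  ∎
    where open ≡-Reasoning

  overlap↭H : map h (range t m) ↭ map H (range 1 m)
  overlap↭H = begin
    map h (range t m)                                      ≡⟨ h-second-range m m≤ℓ ⟩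
    map (λ j → Second.fill (at p j)) (range 0 m)           ↭⟨ map⁺ _ q-permutes ⟨
    map (λ j → Second.fill (at p j)) (map q (range 1 m))   ≡⟨ List.map-∘ (range 1 m) ⟨
    map (λ s → Second.fill (at p (q s))) (range 1 m)       ≡⟨ map-cong-range _ H 1 m fill-q≡H ⟩
    map H (range 1 m)                                      ∎
    where
    open PermutationReasoning
    fill-q≡H : ∀ j → j < m → Second.fill (at p (q (suc j))) ≡ H (suc j)
    fill-q≡H j j<m = trans (cong Second.fill (sym (B≡at (suc j) (s≤s z≤n) j<m))) (Second.fill-anchor (suc j) j<m)

  W↭M : W ↭ M (extMultiplicities p i σ)
  W↭M = subst (W ↭_) (sym (M≡Mfrom0 (extMultiplicities p i σ)))
    (↭-cancelˡ Xs (↭-trans (++-comm Xs W) (↭-trans W++Xs↭ (++-comm _ Xs))))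
    where
    open PermutationReasoning
    Fs = map h (range 0 ℓ)
    Xs = map h (range t m)
    Zs = map h (range ℓ t)
    W++Xs↭ : W ++ Xs ↭ Mfrom 0 (extMultiplicities p i σ) ++ Xs
    W++Xs↭ = begin
      W ++ Xs                                 ≡⟨ cong (_++ Xs) W-split ⟩
      (Fs ++ Zs) ++ Xs                        ↭⟨ ↭-trans (++-assoc Fs Zs Xs) (++⁺ˡ Fs (++-comm Zs Xs)) ⟩
      Fs ++ (Xs ++ Zs)                        ≡⟨ cong₂ _++_ first-copy second-copy ⟨
      map First.fill p ++ map Second.fill p   ↭⟨ ++-comm (map First.fill p) _ ⟩
      map Second.fill p ++ map First.fill p   ↭⟨ ++⁺ (map⁺ Second.fill p↭1…ℓ) (map⁺ First.fill p↭1…ℓ) ⟩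
      map Second.fill (range 1 ℓ) ++ map First.fill (range 1 ℓ)
                                              ↭⟨ extMultiplicities-balance ⟨
      Mfrom 0 (extMultiplicities p i σ) ++ map H (range 1 m)
                                              ↭⟨ ++⁺ˡ _ overlap↭H ⟨
      Mfrom 0 (extMultiplicities p i σ) ++ Xs ∎

  W-extended : IsExtendedPerm p i W
  W-extended = W-overlaps , W-least

lemma4p8 : (p : List ℕ) → IsPattern p → (i : ℕ) → Extendable p i →
    (σ : ℕ → ℕ) → IsSortingPerm p i σ →
    ∃ (IsExtendedPerm p i)
    × (∀ w → IsExtendedPerm p i w → w ↭ M (extMultiplicities p i σ))
lemma4p8 p pat (suc zero) (s≤s () , _) σ σ-sorts
lemma4p8 p pat (suc (suc t′)) (_ , i≤ℓ , w₀ , _ , _ , w₀-occ₀ , w₀-occₜ) σ σ-sorts =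
  (W , W-extended) , λ w w-extended → subst (_↭ M (extMultiplicities p i σ)) (W≡w w-extended) W↭M
  where
  open Extension p pat t′ i≤ℓ {w₀} w₀-occ₀ w₀-occₜ σ σ-sorts
  W≡w : ∀ {w} → IsExtendedPerm p i w → W ≡ w
  W≡w (w-overlaps , w-least) = LexLe-antisym (W-least _ w-overlaps) (w-least W W-overlaps)
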